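{- Let $h:G\to H$ be a surjective homomorphism of groups with finite kernel $K$. Then for every non-empty finite subset $A\subseteq H$ we have $\Delta[h^{ -1}(A)]\le \Delta[A]\cdot\Delta[K]$.
   Context: For a subset $A$ of a group $G$, a subset $B\subseteq G$ is a difference basis for $A$ if every $a\in A$ can be written as $a=xy^{ -1}$ with $x,y\in B$. The difference size $\Delta[A]$ is the smallest cardinality of a difference basis for $A$ (differences computed in the ambient group: $\Delta[A]$ for $A\subseteq H$ in $H$, $\Delta[h^{ -1}(A)]$ and $\Delta[K]$ in $G$). -}

module Defs where

open import Level using (Level; _⊔_)
open import Data.Nat using (ℕ; _≤_)
open import Data.Product using (Σ; _×_)
open import Data.List using (List; length)
open import Data.List.Relation.Unary.Any using (Any)
open import Relation.Binary.PropositionalEquality using (_≡_)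
open import Algebra.Bundles using (Group)

module _ {c ℓ : Level} (G : Group c ℓ) where
  open Group G

  IsDiffBasis : {p : Level} → (Carrier → Set p) → List Carrier → Set (c ⊔ ℓ ⊔ p)
  IsDiffBasis P B = ∀ a → P a → Any (λ x → Any (λ y → a ≈ (x ∙ (y ⁻¹))) B) B

  -- Δ[P] = n : n is the least cardinality of a difference basis of P.
  -- (Lists may contain repetitions; this does not change the minimum.)
  IsDiffSize : {p : Level} → (Carrier → Set p) → ℕ → Set (c ⊔ ℓ ⊔ p)
  IsDiffSize P n =
    Σ (List Carrier) (λ B → IsDiffBasis P B × length B ≡ n)
    × (∀ B → IsDiffBasis P B → n ≤ length B)

  IsFiniteSubset : {p : Level} → (Carrier → Set p) → Set (c ⊔ ℓ ⊔ p)
  IsFiniteSubset P = Σ (List Carrier) (λ L → ∀ g → P g → Any (λ x → g ≈ x) L)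

-- Fix a difference basis B of A and a difference basis C of the kernel K, and choose
-- preimages lift b ∈ G of the b ∈ B. If h g = b₁ b₂⁻¹ with bᵢ ∈ B, then
-- (lift b₁)⁻¹ g (lift b₂) lies in K, so it equals κ₁ κ₂⁻¹ with κᵢ ∈ C, whence
-- g = (lift b₁ κ₁)(lift b₂ κ₂)⁻¹. So the |B|·|C| products lift b κ form a difference
-- basis of h⁻¹(A).
module Submission where

open import Defs
open import Level using (Level)
open import Data.Nat using (ℕ; _≤_; _*_; _+_)
open import Data.Product using (_,_; proj₁; proj₂)
open import Data.List using (List; []; _∷_; length; map; cartesianProductWith)
open import Data.List.Properties using (length-++; length-map)
open import Data.List.Relation.Unary.Any using (Any)
open import Data.List.Membership.Propositional using (find; lose)
open import Data.List.Membership.Propositional.Properties using (∈-cartesianProductWith⁺)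
open import Relation.Binary.PropositionalEquality using (_≡_; _≢_; refl; cong₂; subst; trans)
open import Algebra.Bundles using (Group)
open import Algebra.Morphism.Structures using (IsGroupHomomorphism)
open import Function.Definitions using (Surjective)
import Algebra.Properties.Group as GroupProperties
import Relation.Binary.Reasoning.Setoid as SetoidReasoning

length-cartesianProductWith : ∀ {a b c} {A : Set a} {B : Set b} {C : Set c}
  (f : A → B → C) (xs : List A) (ys : List B) →
  length (cartesianProductWith f xs ys) ≡ length xs * length ys
length-cartesianProductWith f []       ys = refl
length-cartesianProductWith f (x ∷ xs) ys =
  trans (length-++ (map (f x) ys))
        (cong₂ _+_ (length-map (f x) ys) (length-cartesianProductWith f xs ys))

module _ {c ℓ : Level} (G : Group c ℓ) where
  open Group G
  open GroupProperties G
  open SetoidReasoning setoid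

  x⁻¹∙[x∙y⁻¹]∙y≈ε : ∀ x y → x ⁻¹ ∙ (x ∙ y ⁻¹) ∙ y ≈ ε
  x⁻¹∙[x∙y⁻¹]∙y≈ε x y = begin
    x ⁻¹ ∙ (x ∙ y ⁻¹) ∙ y  ≈⟨ ∙-congʳ (\\-leftDividesʳ x (y ⁻¹)) ⟩
    y ⁻¹ ∙ y               ≈⟨ inverseˡ y ⟩
    ε                      ∎

  x⁻¹∙z∙y≈u∙v⁻¹⇒z≈x∙u∙[y∙v]⁻¹ : ∀ x y z u v →
    x ⁻¹ ∙ z ∙ y ≈ u ∙ v ⁻¹ → z ≈ x ∙ u ∙ (y ∙ v) ⁻¹
  x⁻¹∙z∙y≈u∙v⁻¹⇒z≈x∙u∙[y∙v]⁻¹ x y z u v eq = begin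
    z                          ≈⟨ \\-leftDividesˡ x z ⟨
    x ∙ (x ⁻¹ ∙ z)             ≈⟨ ∙-congˡ (//-rightDividesʳ y (x ⁻¹ ∙ z)) ⟨
    x ∙ (x ⁻¹ ∙ z ∙ y ∙ y ⁻¹)  ≈⟨ ∙-congˡ (∙-congʳ eq) ⟩
    x ∙ (u ∙ v ⁻¹ ∙ y ⁻¹)      ≈⟨ ∙-congˡ (assoc u (v ⁻¹) (y ⁻¹)) ⟩
    x ∙ (u ∙ (v ⁻¹ ∙ y ⁻¹))    ≈⟨ assoc x u (v ⁻¹ ∙ y ⁻¹) ⟨
    x ∙ u ∙ (v ⁻¹ ∙ y ⁻¹)      ≈⟨ ∙-congˡ (⁻¹-anti-homo-∙ y v) ⟨
    x ∙ u ∙ (y ∙ v) ⁻¹         ∎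

module Lifting {c₁ ℓ₁ c₂ ℓ₂ : Level} (G : Group c₁ ℓ₁) (H : Group c₂ ℓ₂)
  (h : Group.Carrier G → Group.Carrier H)
  (hom : IsGroupHomomorphism (Group.rawGroup G) (Group.rawGroup H) h)
  (surj : Surjective (Group._≈_ G) (Group._≈_ H) h) where
  private
    module G = Group G
    module H = Group H
  open IsGroupHomomorphism hom

  lift : H.Carrier → G.Carrier
  lift b = proj₁ (surj b)

  h∘lift≈id : ∀ b → h (lift b) H.≈ b
  h∘lift≈id b = proj₂ (surj b) G.refl

  Kernel : G.Carrier → Set ℓ₂
  Kernel g = h g H.≈ H.ε

  lift∙ : List H.Carrier → List G.Carrier → List G.Carrier
  lift∙ = cartesianProductWith (λ b κ → lift b G.∙ κ)

  lift⁻¹∙g∙lift∈Kernel : ∀ g b₁ b₂ → h g H.≈ b₁ H.∙ b₂ H.⁻¹ →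
    Kernel (lift b₁ G.⁻¹ G.∙ g G.∙ lift b₂)
  lift⁻¹∙g∙lift∈Kernel g b₁ b₂ hg≈ = begin
    h (lift b₁ G.⁻¹ G.∙ g G.∙ lift b₂)          ≈⟨ homo _ _ ⟩
    h (lift b₁ G.⁻¹ G.∙ g) H.∙ h (lift b₂)      ≈⟨ H.∙-congʳ (homo _ _) ⟩
    h (lift b₁ G.⁻¹) H.∙ h g H.∙ h (lift b₂)    ≈⟨ H.∙-cong (H.∙-cong h⁻¹ hg≈) (h∘lift≈id b₂) ⟩
    b₁ H.⁻¹ H.∙ (b₁ H.∙ b₂ H.⁻¹) H.∙ b₂         ≈⟨ x⁻¹∙[x∙y⁻¹]∙y≈ε H b₁ b₂ ⟩
    H.ε                                         ∎
    where
    open SetoidReasoning H.setoid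
    h⁻¹ : h (lift b₁ G.⁻¹) H.≈ b₁ H.⁻¹
    h⁻¹ = H.trans (⁻¹-homo (lift b₁)) (H.⁻¹-cong (h∘lift≈id b₁))

  lift∙-isDiffBasis-preimage : ∀ {p} {P : H.Carrier → Set p} {B C} →
    IsDiffBasis H P B → IsDiffBasis G Kernel C →
    IsDiffBasis G (λ g → P (h g)) (lift∙ B C)
  lift∙-isDiffBasis-preimage basisB basisC g Phg =
    let b₁ , b₁∈B , ∃b₂ = find (basisB (h g) Phg)
        b₂ , b₂∈B , hg≈ = find ∃b₂
        κ₁ , κ₁∈C , ∃κ₂ = find (basisC _ (lift⁻¹∙g∙lift∈Kernel g b₁ b₂ hg≈))
        κ₂ , κ₂∈C , conj≈ = find ∃κ₂
    in lose (∈-cartesianProductWith⁺ _ b₁∈B κ₁∈C)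
            (lose (∈-cartesianProductWith⁺ _ b₂∈B κ₂∈C)
                  (x⁻¹∙z∙y≈u∙v⁻¹⇒z≈x∙u∙[y∙v]⁻¹ G (lift b₁) (lift b₂) g κ₁ κ₂ conj≈))

proposition4p2 : {c₁ ℓ₁ c₂ ℓ₂ : Level} (G : Group c₁ ℓ₁) (H : Group c₂ ℓ₂)
    (h : Group.Carrier G → Group.Carrier H)
    → IsGroupHomomorphism (Group.rawGroup G) (Group.rawGroup H) h
    → Surjective (Group._≈_ G) (Group._≈_ H) h
    → IsFiniteSubset G (λ g → Group._≈_ H (h g) (Group.ε H))
    → (A : List (Group.Carrier H)) → A ≢ []
    → (a k d : ℕ)
    → IsDiffSize H (λ y → Any (λ x → Group._≈_ H y x) A) a
    → IsDiffSize G (λ g → Group._≈_ H (h g) (Group.ε H)) k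
    → IsDiffSize G (λ g → Any (λ x → Group._≈_ H (h g) x) A) d
    → d ≤ a * k
proposition4p2 G H h hom surj _ A _ a k d
  ((B , basisB , |B|≡a) , _) ((C , basisC , |C|≡k) , _) (_ , minimal) =
  subst (d ≤_) |lift∙BC|≡a*k (minimal (lift∙ B C) (lift∙-isDiffBasis-preimage basisB basisC))
  where
  open Lifting G H h hom surj
  |lift∙BC|≡a*k : length (lift∙ B C) ≡ a * k
  |lift∙BC|≡a*k = trans (length-cartesianProductWith _ B C) (cong₂ _*_ |B|≡a |C|≡k)
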